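{- Let $E$ be a simple Edge Firing Game (as defined in the context). Let $C$ and $C'$ be two configurations in the configuration space of $E$ such that $C \ge C'$. If $\sigma$ and $\sigma'$ are two sequences of firings which both transform $C$ into $C'$, then the set of vertices fired during $\sigma$ equals the set of vertices fired during $\sigma'$.
   Context: An Edge Firing Game (EFG) is given by a connected undirected graph $G=(V,E)$, a distinguished vertex $s\in V$ called the sink, and an orientation $G_0$ of $G$ (an orientation assigns to each edge $\{v,v'\}\in E$ exactly one of the directions $(v,v')$ or $(v',v)$). Configurations are orientations of $G$; $G_0$ is the initial configuration. Firing rule: if in configuration $C$ some vertex $\nu\neq s$ has only incoming edges (no outgoing edges), one may fire $\nu$, i.e. reverse all edges incident to $\nu$ (each $(v,\nu)$ becomes $(\nu,v)$), obtaining a new configuration $C'$; we write $C\to C'$. The configuration space is the set of configurations reachable from $G_0$ by sequences of firings, ordered by $C\ge C'$ iff some (possibly empty) sequence of firings transforms $C$ into $C'$. The EFG is called simple if, in any sequence of firings starting from the initial configuration, each vertex is fired at most once. -}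

module Defs where

open import Data.Nat using (ℕ)
open import Data.Fin using (Fin; _≟_)
open import Data.Bool using (Bool; true; false; not; if_then_else_)
open import Data.Vec using (Vec; lookup; tabulate)
open import Data.Product using (_×_; _,_; proj₁; proj₂; ∃; ∃-syntax; Σ-syntax)
open import Data.Sum using (_⊎_)
open import Data.List using (List; []; _∷_)
open import Data.List.Membership.Propositional using (_∈_)
open import Data.List.Relation.Unary.Unique.Propositional using (Unique)
open import Relation.Nullary using (¬_; yes; no)
open import Relation.Binary.PropositionalEquality using (_≡_; _≢_)
open import Relation.Binary.Construct.Closure.ReflexiveTransitive using (Star)

-- An undirected (simple) graph on vertex set Fin n with m edges,
-- edge i having endpoints  edges[i] = (a , b).
-- An orientation is a vector of m booleans:
--   true  : edge i is directed (a , b)   (from a to b)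
--   false : edge i is directed (b , a)   (from b to a)
Orientation : ℕ → Set
Orientation m = Vec Bool m

module _ {n m : ℕ} (edges : Vec (Fin n × Fin n) m) where

  src : Fin m → Fin n
  src i = proj₁ (lookup edges i)

  tgt : Fin m → Fin n
  tgt i = proj₂ (lookup edges i)

  SimpleGraph : Set
  SimpleGraph =
    (∀ i → src i ≢ tgt i) ×
    (∀ i j → ((src i ≡ src j × tgt i ≡ tgt j) ⊎ (src i ≡ tgt j × tgt i ≡ src j)) → i ≡ j)

  Adjacent : Fin n → Fin n → Set
  Adjacent u v = ∃[ i ] ((src i ≡ u × tgt i ≡ v) ⊎ (src i ≡ v × tgt i ≡ u))

  Connected : Set
  Connected = ∀ u v → Star Adjacent u v

  Incident : Fin m → Fin n → Set
  Incident i v = src i ≡ v ⊎ tgt i ≡ v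

  head : Orientation m → Fin m → Fin n
  head C i = if lookup C i then tgt i else src i

  OnlyIncoming : Orientation m → Fin n → Set
  OnlyIncoming C ν = ∀ i → Incident i ν → head C i ≡ ν

  isIncident : Fin m → Fin n → Bool
  isIncident i v with src i ≟ v | tgt i ≟ v
  ... | yes _ | _ = true
  ... | no _ | yes _ = true
  ... | no _ | no _ = false

  fire : Orientation m → Fin n → Orientation m
  fire C ν = tabulate λ i → if isIncident i ν then not (lookup C i) else lookup C i

  module _ (s : Fin n) where

    data FiringSeq : Orientation m → List (Fin n) → Orientation m → Set where
      done : ∀ {C} → FiringSeq C [] C
      step : ∀ {C C' ν σ} → ν ≢ s → OnlyIncoming C ν →
             FiringSeq (fire C ν) σ C' → FiringSeq C (ν ∷ σ) C'

    _≽_ : Orientation m → Orientation m → Set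
    C ≽ C' = ∃[ σ ] FiringSeq C σ C'

    module _ (G₀ : Orientation m) where

      InConfigSpace : Orientation m → Set
      InConfigSpace C = G₀ ≽ C

      SimpleEFG : Set
      SimpleEFG = ∀ σ C → FiringSeq G₀ σ C → Unique σ

-- Firing ν flips exactly the edges incident to ν, so the final orientation of an edge {u, v}
-- depends only on the parities with which u and v were fired. Two firing sequences from C to C'
-- therefore agree, on every edge, in the xor of the firing parities of its endpoints; hence the
-- difference of their parity functions is constant along edges, so constant on the connected
-- graph, and it vanishes at the sink, which is never fired. In a simple EFG no vertex fires twice
-- after G₀, so a vertex is fired by a sequence iff it is fired an odd number of times.
module Submission where

open import Defs
open import Data.Nat using (ℕ)
open import Data.Fin using (Fin; _≟_)
open import Data.Product using (_×_; _,_; proj₁)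
open import Data.Sum using (inj₁; inj₂)
open import Data.Vec using (Vec; lookup)
open import Data.Vec.Properties using (lookup∘tabulate)
open import Data.List using (List; []; _∷_; _++_)
open import Data.List.Membership.Propositional using (_∈_; _∉_)
open import Data.List.Relation.Unary.Any using (here; there)
open import Data.List.Relation.Unary.All as All using ()
open import Data.List.Relation.Unary.Unique.Propositional using (Unique)
open import Data.List.Relation.Unary.AllPairs using (_∷_)
open import Data.Bool using (Bool; true; false; not; _xor_; if_then_else_)
open import Data.Bool.Properties using (xor-assoc; xor-comm; xor-identityʳ; xor-same; xor-∧-commutativeRing)
open import Algebra.Bundles using (CommutativeRing)
open CommutativeRing xor-∧-commutativeRing using (+-commutativeSemigroup; +-group)
open import Algebra.Properties.CommutativeSemigroup +-commutativeSemigroup using (interchange)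
-- In this group x ⁻¹ is x itself, so x∙y⁻¹≈ε⇒x≈y reads: x xor y ≡ false → x ≡ y.
open import Algebra.Properties.Group +-group using (∙-cancelˡ; x∙y⁻¹≈ε⇒x≈y)
open import Data.Empty using (⊥-elim)
open import Relation.Nullary using (yes; no; does)
open import Relation.Binary.Definitions using (DecidableEquality)
open import Relation.Binary.PropositionalEquality
open import Relation.Binary.Construct.Closure.ReflexiveTransitive using (fold)
open import Function using (_∘_)
open import Function.Bundles using (_⇔_; mk⇔)

Unique-++⁻ʳ : ∀ {a} {A : Set a} (xs : List A) {ys : List A} → Unique (xs ++ ys) → Unique ys
Unique-++⁻ʳ []       u       = u
Unique-++⁻ʳ (_ ∷ xs) (_ ∷ u) = Unique-++⁻ʳ xs u

module _ {a} {A : Set a} (_≟ᴬ_ : DecidableEquality A) where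

  occursOddly : A → List A → Bool
  occursOddly u []      = false
  occursOddly u (v ∷ σ) = does (u ≟ᴬ v) xor occursOddly u σ

  occursOddly-∉ : ∀ {u σ} → u ∉ σ → occursOddly u σ ≡ false
  occursOddly-∉ {u} {[]}    _   = refl
  occursOddly-∉ {u} {v ∷ σ} u∉ with u ≟ᴬ v
  ... | yes u≡v = ⊥-elim (u∉ (here u≡v))
  ... | no  _   = occursOddly-∉ (u∉ ∘ there)

  occursOddly⇒∈ : ∀ {u} σ → occursOddly u σ ≡ true → u ∈ σ
  occursOddly⇒∈ {u} (v ∷ σ) odd with u ≟ᴬ v
  ... | yes u≡v = here u≡v
  ... | no  _   = there (occursOddly⇒∈ σ odd)

  ∈⇒occursOddly : ∀ {u σ} → Unique σ → u ∈ σ → occursOddly u σ ≡ true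
  ∈⇒occursOddly {u} (v∉σ ∷ _) (here refl) with u ≟ᴬ u
  ... | yes _   = cong not (occursOddly-∉ λ u∈σ → All.lookup v∉σ u∈σ refl)
  ... | no  u≢u = ⊥-elim (u≢u refl)
  ∈⇒occursOddly {u} {v ∷ _} (v∉σ ∷ uσ) (there u∈σ) with u ≟ᴬ v
  ... | yes refl = ⊥-elim (All.lookup v∉σ u∈σ refl)
  ... | no  _    = ∈⇒occursOddly uσ u∈σ

  ∈⇔∈-of-occursOddly : ∀ {σ σ'} → Unique σ → Unique σ' →
    (∀ u → occursOddly u σ ≡ occursOddly u σ') → ∀ u → (u ∈ σ) ⇔ (u ∈ σ')
  ∈⇔∈-of-occursOddly {σ} {σ'} uσ uσ' same u = mk⇔
    (λ u∈σ  → occursOddly⇒∈ σ' (trans (sym (same u)) (∈⇒occursOddly uσ u∈σ)))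
    (λ u∈σ' → occursOddly⇒∈ σ  (trans (same u) (∈⇒occursOddly uσ' u∈σ')))

module _ {n m : ℕ} (edges : Vec (Fin n × Fin n) m) where

  private
    src′ tgt′ : Fin m → Fin n
    src′ = src edges
    tgt′ = tgt edges

  Connected⇒constant : ∀ {b} {B : Set b} (f : Fin n → B) →
    (∀ i → f (src′ i) ≡ f (tgt′ i)) → Connected edges → ∀ u v → f u ≡ f v
  Connected⇒constant f along-edges connected u v =
    fold (λ x y → f x ≡ f y) (λ adj eq → trans (along-adjacent adj) eq) refl (connected u v)
    where
    along-adjacent : ∀ {x y} → Adjacent edges x y → f x ≡ f y
    along-adjacent (i , inj₁ (refl , refl)) = along-edges i
    along-adjacent (i , inj₂ (refl , refl)) = sym (along-edges i)

  lookup-fire : ∀ C ν i → lookup (fire edges C ν) i ≡ isIncident edges i ν xor lookup C i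
  lookup-fire C ν i
    rewrite lookup∘tabulate (λ j → if isIncident edges j ν then not (lookup C j) else lookup C j) i
    with isIncident edges i ν
  ... | true  = refl
  ... | false = refl

  isIncident-xor : ∀ i v → src′ i ≢ tgt′ i →
    isIncident edges i v ≡ does (src′ i ≟ v) xor does (tgt′ i ≟ v)
  isIncident-xor i v loopless with src′ i ≟ v | tgt′ i ≟ v
  ... | yes s≡v | yes t≡v = ⊥-elim (loopless (trans s≡v (sym t≡v)))
  ... | yes _   | no  _   = refl
  ... | no  _   | yes _   = refl
  ... | no  _   | no  _   = refl

  endpointParity : List (Fin n) → Fin m → Bool
  endpointParity σ i = occursOddly _≟_ (src′ i) σ xor occursOddly _≟_ (tgt′ i) σ

  module _ (s : Fin n) where

    FiringSeq-++ : ∀ {A τ B σ D} → FiringSeq edges s A τ B → FiringSeq edges s B σ D →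
      FiringSeq edges s A (τ ++ σ) D
    FiringSeq-++ done                   f = f
    FiringSeq-++ (step ν≢s incoming fτ) f = step ν≢s incoming (FiringSeq-++ fτ f)

    sink-∉-FiringSeq : ∀ {C σ C'} → FiringSeq edges s C σ C' → s ∉ σ
    sink-∉-FiringSeq (step ν≢s _ _) (here s≡ν) = ν≢s (sym s≡ν)
    sink-∉-FiringSeq (step _ _ fσ)  (there s∈σ) = sink-∉-FiringSeq fσ s∈σ

    FiringSeq-Unique : ∀ {G₀ C σ C'} → SimpleEFG edges s G₀ → InConfigSpace edges s G₀ C →
      FiringSeq edges s C σ C' → Unique σ
    FiringSeq-Unique simple (τ , fτ) fσ = Unique-++⁻ʳ τ (simple _ _ (FiringSeq-++ fτ fσ))

    lookup-FiringSeq : (∀ i → src′ i ≢ tgt′ i) → ∀ {C σ C'} → FiringSeq edges s C σ C' →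
      ∀ i → lookup C' i ≡ lookup C i xor endpointParity σ i
    lookup-FiringSeq loopless {C} done i = sym (xor-identityʳ (lookup C i))
    lookup-FiringSeq loopless {C} {ν ∷ σ} {C'} (step _ _ fσ) i = begin
      lookup C' i                                          ≡⟨ lookup-FiringSeq loopless fσ i ⟩
      lookup (fire edges C ν) i xor endpointParity σ i     ≡⟨ cong (_xor endpointParity σ i) (lookup-fire C ν i) ⟩
      (isIncident edges i ν xor c) xor endpointParity σ i  ≡⟨ cong (λ x → (x xor c) xor endpointParity σ i) (isIncident-xor i ν (loopless i)) ⟩
      ((eₛ xor eₜ) xor c) xor (oₛ xor oₜ)                  ≡⟨ cong (_xor (oₛ xor oₜ)) (xor-comm (eₛ xor eₜ) c) ⟩
      (c xor (eₛ xor eₜ)) xor (oₛ xor oₜ)                  ≡⟨ xor-assoc c (eₛ xor eₜ) (oₛ xor oₜ) ⟩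
      c xor ((eₛ xor eₜ) xor (oₛ xor oₜ))                  ≡⟨ cong (c xor_) (interchange eₛ eₜ oₛ oₜ) ⟩
      c xor endpointParity (ν ∷ σ) i                       ∎
      where
      open ≡-Reasoning
      c  = lookup C i
      eₛ = does (src′ i ≟ ν)
      eₜ = does (tgt′ i ≟ ν)
      oₛ = occursOddly _≟_ (src′ i) σ
      oₜ = occursOddly _≟_ (tgt′ i) σ

    occursOddly-FiringSeq : (∀ i → src′ i ≢ tgt′ i) → Connected edges →
      ∀ {C σ σ' C'} → FiringSeq edges s C σ C' → FiringSeq edges s C σ' C' →
      ∀ u → occursOddly _≟_ u σ ≡ occursOddly _≟_ u σ'
    occursOddly-FiringSeq loopless connected {C} {σ} {σ'} fσ fσ' u =
      x∙y⁻¹≈ε⇒x≈y _ _ (trans (Connected⇒constant difference along-edges connected u s) at-sink)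
      where
      difference : Fin n → Bool
      difference v = occursOddly _≟_ v σ xor occursOddly _≟_ v σ'

      same-endpointParity : ∀ i → endpointParity σ i ≡ endpointParity σ' i
      same-endpointParity i = ∙-cancelˡ (lookup C i) _ _
        (trans (sym (lookup-FiringSeq loopless fσ i)) (lookup-FiringSeq loopless fσ' i))

      along-edges : ∀ i → difference (src′ i) ≡ difference (tgt′ i)
      along-edges i = x∙y⁻¹≈ε⇒x≈y _ _ (begin
        difference (src′ i) xor difference (tgt′ i)  ≡⟨ interchange oₛ oₛ′ oₜ oₜ′ ⟩
        endpointParity σ i xor endpointParity σ' i    ≡⟨ cong (_xor endpointParity σ' i) (same-endpointParity i) ⟩
        endpointParity σ' i xor endpointParity σ' i   ≡⟨ xor-same (endpointParity σ' i) ⟩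
        false                                         ∎)
        where
        open ≡-Reasoning
        oₛ  = occursOddly _≟_ (src′ i) σ
        oₛ′ = occursOddly _≟_ (src′ i) σ'
        oₜ  = occursOddly _≟_ (tgt′ i) σ
        oₜ′ = occursOddly _≟_ (tgt′ i) σ'

      at-sink : difference s ≡ false
      at-sink = cong₂ _xor_ (occursOddly-∉ _≟_ (sink-∉-FiringSeq fσ)) (occursOddly-∉ _≟_ (sink-∉-FiringSeq fσ'))

lemma1 : {n m : ℕ} (edges : Vec (Fin n × Fin n) m) (s : Fin n) (G₀ : Orientation m) →
    SimpleGraph edges → Connected edges →
    SimpleEFG edges s G₀ →
    (C C' : Orientation m) → InConfigSpace edges s G₀ C → InConfigSpace edges s G₀ C' →
    _≽_ edges s C C' →
    (σ σ' : List (Fin n)) → FiringSeq edges s C σ C' → FiringSeq edges s C σ' C' →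
    (∀ v → (v ∈ σ) ⇔ (v ∈ σ'))
lemma1 edges s G₀ simpleGraph connected simple C C' reachableC _ _ σ σ' fσ fσ' =
  ∈⇔∈-of-occursOddly _≟_
    (FiringSeq-Unique edges s simple reachableC fσ)
    (FiringSeq-Unique edges s simple reachableC fσ')
    (occursOddly-FiringSeq edges s (proj₁ simpleGraph) connected fσ fσ')
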